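{- Let $\mathcal{S}=\langle\mathcal{L},\vdash\rangle$ be a logic (with $\mathcal{L}$ a formula algebra over a denumerable set of variables $V$) having a falsity constant $\bot\in\mathcal{L}$. Then the left variable inclusion companion $\mathcal{S}^l=\langle\mathcal{L},\vdash^l\rangle$ and the pure left variable inclusion companion $\mathcal{S}^{pl}=\langle\mathcal{L},\vdash^{pl}\rangle$ are not NF-paraconsistent.
   Context: A logic is a pair $\langle\mathcal{L},\vdash\rangle$ with $\vdash\,\subseteq\mathcal{P}(\mathcal{L})\times\mathcal{L}$, and $C_\vdash(\Gamma)=\{\alpha:\Gamma\vdash\alpha\}$. Here $\mathcal{L}$ is the set of formulas built inductively over a denumerable set $V$ of variables using a finite set of connectives (possibly including nullary ones). For $\alpha\in\mathcal{L}$, $\mathrm{var}(\alpha)$ is the set of variables occurring in $\alpha$, and $\mathrm{var}(\Delta)=\bigcup_{\alpha\in\Delta}\mathrm{var}(\alpha)$. A falsity constant is a constant $\bot\in\mathcal{L}$ (so $\mathrm{var}(\bot)=\emptyset$) such that $\{\bot\}\vdash\alpha$ for all $\alpha\in\mathcal{L}$. The relation $\vdash^l$: $\Gamma\vdash^l\alpha$ iff there is $\Delta\subseteq\Gamma$ with $\mathrm{var}(\Delta)\subseteq\mathrm{var}(\alpha)$ and $\Delta\vdash\alpha$. The relation $\vdash^{pl}$: $\Gamma\vdash^{pl}\alpha$ iff there is a nonempty $\Delta\subseteq\Gamma$ with $\mathrm{var}(\Delta)\subseteq\mathrm{var}(\alpha)$ and $\Delta\vdash\alpha$. A logic $\langle\mathcal{L},\vdash\rangle$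 is NF-paraconsistent if there exists $\alpha\in\mathcal{L}$ such that $C_\vdash(\{\alpha,\beta\})\neq\mathcal{L}$ for every $\beta\in\mathcal{L}$. -}

module Defs where

open import Data.Nat using (ℕ)
open import Data.Fin using (Fin)
open import Data.Vec using (Vec)
open import Data.Vec.Relation.Unary.Any using (Any)
open import Data.Product using (Σ; ∃; ∃-syntax; _×_)
open import Data.Sum using (_⊎_)
open import Data.Empty using (⊥)
open import Relation.Nullary using (¬_)
open import Relation.Binary.PropositionalEquality using (_≡_)
open import Level using (Level; suc; zero)

record Signature : Set where
  field
    k     : ℕ
    arity : Fin k → ℕ
open Signature public

module _ (Σs : Signature) where

  data Formula : Set where
    var : ℕ → Formula
    app : (c : Fin (k Σs)) → Vec Formula (arity Σs c) → Formula

  data _occursIn_ (x : ℕ) : Formula → Set where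
    here  : x occursIn var x
    under : ∀ {c args} → Any (x occursIn_) args → x occursIn app c args

  FSet : Set₁
  FSet = Formula → Set

  _⊆_ : FSet → FSet → Set
  Δ ⊆ Γ = ∀ β → Δ β → Γ β

  VarsIncl : FSet → Formula → Set
  VarsIncl Δ α = ∀ x → (∃[ β ] (Δ β × x occursIn β)) → x occursIn α

  Rel⊢ : Set₂
  Rel⊢ = FSet → Formula → Set₁

  ⟦_,_⟧ : Formula → Formula → FSet
  ⟦ α , β ⟧ γ = (γ ≡ α) ⊎ (γ ≡ β)

  ⟦_⟧ : Formula → FSet
  ⟦ α ⟧ γ = γ ≡ α

  IsConstant : Formula → Set
  IsConstant f = ∃[ c ] ∃[ args ] (f ≡ app c args × arity Σs c ≡ 0)

  IsFalsityConstant : Rel⊢ → Formula → Set₁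
  IsFalsityConstant _⊢_ f = IsConstant f × (∀ α → ⟦ f ⟧ ⊢ α)

  left : Rel⊢ → Rel⊢
  left _⊢_ Γ α = ∃[ Δ ] (Δ ⊆ Γ × VarsIncl Δ α × Δ ⊢ α)

  pureLeft : Rel⊢ → Rel⊢
  pureLeft _⊢_ Γ α = ∃[ Δ ] ((∃[ β ] Δ β) × Δ ⊆ Γ × VarsIncl Δ α × Δ ⊢ α)

  NFParaconsistent : Rel⊢ → Set₁
  NFParaconsistent _⊢_ = ∃[ α ] (∀ β → ¬ (∀ γ → ⟦ α , β ⟧ ⊢ γ))

-- A falsity constant ⊥ has no variables, so {⊥} satisfies the variable inclusion
-- condition for every conclusion; hence in both companions every set containing ⊥
-- still proves everything. Taking β = ⊥ makes {α, β} trivial for every α.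
module Submission where

open import Defs
open import Data.Product using (_×_; ∃-syntax; _,_; proj₁; proj₂)
open import Data.Sum using (inj₂)
open import Data.Vec using (Vec; [])
open import Data.Vec.Relation.Unary.Any using (Any)
open import Data.Empty using (⊥-elim)
open import Relation.Nullary using (¬_)
open import Relation.Binary.PropositionalEquality using (_≡_; refl)

module _ {Σs : Signature} where

  private
    no-Any-in-[] : ∀ {P : Formula Σs → Set} {n} (v : Vec (Formula Σs) n) → n ≡ 0 → ¬ Any P v
    no-Any-in-[] [] refl ()

  constant-has-no-vars : ∀ {f} → IsConstant Σs f → ∀ x → ¬ _occursIn_ Σs x f
  constant-has-no-vars (c , args , refl , arity≡0) x (under x∈args) = no-Any-in-[] args arity≡0 x∈args

  constant-varsIncl : ∀ {f} → IsConstant Σs f → ∀ α → VarsIncl Σs (⟦_⟧ Σs f) α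
  constant-varsIncl isConst α x (_ , refl , x∈f) = ⊥-elim (constant-has-no-vars isConst x x∈f)

  singleton-⊆ : ∀ {Γ : FSet Σs} {f} → Γ f → _⊆_ Σs (⟦_⟧ Σs f) Γ
  singleton-⊆ f∈Γ _ refl = f∈Γ

  module _ {_⊢_ : Rel⊢ Σs} {f : Formula Σs} (falsity : IsFalsityConstant Σs _⊢_ f) where

    left-explosive : ∀ {Γ} → Γ f → ∀ γ → left Σs _⊢_ Γ γ
    left-explosive f∈Γ γ =
      ⟦_⟧ Σs f , singleton-⊆ f∈Γ , constant-varsIncl (proj₁ falsity) γ , proj₂ falsity γ

    pureLeft-explosive : ∀ {Γ} → Γ f → ∀ γ → pureLeft Σs _⊢_ Γ γ
    pureLeft-explosive f∈Γ γ =
      ⟦_⟧ Σs f , (f , refl) , singleton-⊆ f∈Γ , constant-varsIncl (proj₁ falsity) γ , proj₂ falsity γ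

  explosive-pair-⇒-¬NFParaconsistent : ∀ (_⊢_ : Rel⊢ Σs) f → (∀ α γ → ⟦_,_⟧ Σs α f ⊢ γ) → ¬ NFParaconsistent Σs _⊢_
  explosive-pair-⇒-¬NFParaconsistent _⊢_ f explosive (α , nontrivial) = nontrivial f (explosive α)

theorem2p13 : (Σs : Signature) (_⊢_ : Rel⊢ Σs) → (∃[ f ] IsFalsityConstant Σs _⊢_ f) → ¬ NFParaconsistent Σs (left Σs _⊢_) × ¬ NFParaconsistent Σs (pureLeft Σs _⊢_)
theorem2p13 Σs _⊢_ (f , falsity) =
  explosive-pair-⇒-¬NFParaconsistent (left Σs _⊢_) f (λ α → left-explosive falsity (inj₂ refl)) ,
  explosive-pair-⇒-¬NFParaconsistent (pureLeft Σs _⊢_) f (λ α → pureLeft-explosive falsity (inj₂ refl))
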